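{- For every integer $n \geq 1$, $$\operatorname{Cat}_{B_n}(q) = \operatorname{Cat}_n(q) + \sum_{k=0}^{n-1} q^{2k+1}\, \operatorname{Cat}_{B_k}(q)\, \operatorname{Cat}_{n-k}(q),$$ where $\operatorname{Cat}_{B_0}(q) = 1$.
   Context: A unit square means a square $[a,a+1]\times[b,b+1]$ with $a,b$ nonnegative integers. Lattice paths use unit north steps $(0,1)$ and east steps $(1,0)$. Type $A$: for $n\ge 1$, a Catalan (Dyck) path of length $n$ is a lattice path from $(0,0)$ to $(n,n)$ with $n$ north and $n$ east steps that never goes below the line $y=x$. Its area is the number of unit squares lying entirely in the region between the path and the line $y=x$ (squares cut in half by $y=x$ are not counted). Set $\operatorname{Cat}_n(q) = \sum_{\lambda} q^{\operatorname{area}(\lambda)}$, the sum over all Catalan paths of length $n$, and $\operatorname{Cat}_0(q)=1$. Type $B$: for $n \geq 1$, a type $B$ Catalan path of length $n$ is a lattice path of $2n$ steps, each north or east, starting at $(0,0)$ and never going below the line $y=x$ (its endpoint lies on the line $x+y=2n$). Its area $\operatorname{area}(\lambda)$ is the number of unit squares in the region bounded by the path, the diagonal $y=x$ and the anti-diagonal $x+y=2n$, where the half-squares cut by the diagonal $y=x$ are not counted but the half-squares cut by the anti-diagonal $x+y=2n$ are counted. Set $\operatorname{Cat}_{B_n}(q) = \sum_\lambda q^{\operatorname{area}(\lambda)}$, the sum over all type $B$ Catalan paths of length $n$, and $\operatorname{Cat}_{B_0}(q)=1$. (For example $\operatorname{Cat}_{B_2}(q)=1+2q+q^2+q^3+q^4$.)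 -}

module Defs where

open import Data.Nat using (ℕ; zero; suc; _+_; _*_; _∸_; _≤ᵇ_; _<ᵇ_)
open import Data.Bool using (Bool; true; false; if_then_else_)
open import Data.List using (List; []; _∷_; map; _++_; length; filter; sum; upTo)
open import Relation.Nullary.Decidable using (does)
open import Relation.Binary.PropositionalEquality using (_≡_)
import Data.Nat as ℕ
import Data.Bool as 𝔹

data Step : Set where
  N E : Step

words : ℕ → List (List Step)
words zero = [] ∷ []
words (suc m) = map (N ∷_) (words m) ++ map (E ∷_) (words m)

-- the path, starting at (x , y), never goes below y = x
-- (every prefix has at least as many N steps as E steps, given y ≥ x at start)
-- here we track d = y - x
aboveDiag : ℕ → List Step → Bool
aboveDiag d [] = true
aboveDiag d (N ∷ s) = aboveDiag (suc d) s
aboveDiag zero (E ∷ s) = false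
aboveDiag (suc d) (E ∷ s) = aboveDiag d s

countN : List Step → ℕ
countN [] = 0
countN (N ∷ s) = suc (countN s)
countN (E ∷ s) = countN s

catPaths : ℕ → List (List Step)
catPaths n = filter (λ w → countN w ℕ.≟ n)
               (filter (λ w → aboveDiag 0 w 𝔹.≟ true) (words (2 * n)))

catBPaths : ℕ → List (List Step)
catBPaths n = filter (λ w → aboveDiag 0 w 𝔹.≟ true) (words (2 * n))

countRange : ℕ → ℕ → (ℕ → Bool) → ℕ
countRange lo zero p = 0
countRange lo (suc k) p = (if p lo then 1 else 0) + countRange (suc lo) k p

-- Unit square [a,a+1]×[b,b+1] in the region: for the north step of the path
-- in row b, starting at (x , b), the squares in row b lying to the right of
-- the path and entirely above y = x are those with x ≤ a and a + 1 ≤ b.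
-- Type A area: all such squares.
-- Type B area (for length n): additionally the square must meet the region
-- below x + y = 2n in more than a boundary point, i.e. a + b + 1 ≤ 2n
-- (squares cut in half by x + y = 2n, a + b + 1 = 2n, are counted).
-- areaWith bound x y path : bound decides admissibility of square (a , b).
areaWith : (ℕ → ℕ → Bool) → ℕ → ℕ → List Step → ℕ
areaWith ok x y [] = 0
areaWith ok x y (N ∷ s) = countRange x (y ∸ x) (λ a → ok a y) + areaWith ok x (suc y) s
areaWith ok x y (E ∷ s) = areaWith ok (suc x) y s

areaA : List Step → ℕ
areaA = areaWith (λ a b → true) 0 0

areaB : ℕ → List Step → ℕ
areaB n = areaWith (λ a b → suc (a + b) ≤ᵇ 2 * n) 0 0

-- Polynomials in q with ℕ coefficients, as coefficient functions:
-- P d = coefficient of q^d.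
Poly : Set
Poly = ℕ → ℕ

countWith : {A : Set} → (A → ℕ) → List A → ℕ → ℕ
countWith f [] d = 0
countWith f (w ∷ ws) d = (if does (ℕ._≟_ (f w) d) then 1 else 0) + countWith f ws d

Cat : ℕ → Poly
Cat zero = λ { zero → 1 ; (suc _) → 0 }
Cat (suc n) = countWith areaA (catPaths (suc n))

CatB : ℕ → Poly
CatB zero = λ { zero → 1 ; (suc _) → 0 }
CatB (suc n) = countWith (areaB (suc n)) (catBPaths (suc n))

_⊕_ : Poly → Poly → Poly
(P ⊕ Q) d = P d + Q d

Σ< : ℕ → (ℕ → ℕ) → ℕ
Σ< zero f = 0
Σ< (suc k) f = Σ< k f + f k

_⊗_ : Poly → Poly → Poly
(P ⊗ Q) d = Σ< (suc d) (λ i → P i * Q (d ∸ i))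

qpow : ℕ → Poly
qpow m d = if does (ℕ._≟_ m d) then 1 else 0

ΣP< : ℕ → (ℕ → Poly) → Poly
ΣP< n P d = Σ< n (λ k → P k d)

_≈P_ : Poly → Poly → Set
P ≈P Q = ∀ d → P d ≡ Q d

module Submission where

-- Read a path step by step: an N step at height h = y - x with r steps to go
-- adds h squares of type A area and h ⊓ r of type B area (the anti-diagonal
-- cuts its row).  The heart is the last-visit
-- decomposition B h r ≋ R h r: a path ends at height 0 or 1 (where truncation
-- never bites, A-trunc), or visits height 1 for the last time and then stays
-- at height ≥ 2 (U), or never comes below height 2 (H₂); both sides obey the
-- same one-step recursion (R-step).  At the origin with r = 2n, parity kills
-- A 1 and the odd tails, and a tail of length 2k + 1 is a type B path of
-- length 2k raised by two, whose area grows by 2k (H₂-raise): this yields the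
-- terms q^{2k+1} Cat_{B_k} Cat_{n-k}.

open import Defs
open import Level using (Level)
open import Data.Nat using (ℕ; zero; suc; _+_; _*_; _∸_; _≤_; _<_; _⊓_; _≡ᵇ_; _≤ᵇ_; s≤s; parity)
open import Data.Nat.Properties
open import Data.Nat.Tactic.RingSolver using (solve-∀)
import Data.Parity.Base as ℙ
open ℙ using (0ℙ; 1ℙ)
open import Data.Parity.Properties using (p+p≡0ℙ) renaming (+-homo-+ to parity-+; *-homo-* to parity-*)
open import Algebra.Properties.CommutativeSemigroup +-commutativeSemigroup using (interchange)
open import Data.Bool using (Bool; true; false; if_then_else_; T)
open import Data.Unit using (tt)
open import Data.Empty using (⊥-elim)
open import Data.List using (List; []; _∷_; map; _++_; filter)
open import Data.List.Properties using (map-++; map-∘; map-cong; map-id; filter-++)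
open import Relation.Nullary.Decidable using (does; yes; no)
open import Relation.Unary using (Pred; Decidable)
open import Relation.Binary.PropositionalEquality using (_≡_; _≢_; refl; sym; trans; cong; cong₂; subst; module ≡-Reasoning)
import Data.Nat as ℕ
import Data.Bool as 𝔹

open ≡-Reasoning

Σ<-cong : ∀ k {f g : ℕ → ℕ} → (∀ i → i < k → f i ≡ g i) → Σ< k f ≡ Σ< k g
Σ<-cong zero    eq = refl
Σ<-cong (suc k) eq = cong₂ _+_ (Σ<-cong k (λ i i<k → eq i (m<n⇒m<1+n i<k))) (eq k ≤-refl)

Σ<-zero : ∀ k → Σ< k (λ _ → 0) ≡ 0
Σ<-zero zero    = refl
Σ<-zero (suc k) = trans (+-identityʳ _) (Σ<-zero k)

Σ<-+ : ∀ k (f g : ℕ → ℕ) → Σ< k (λ i → f i + g i) ≡ Σ< k f + Σ< k g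
Σ<-+ zero    f g = refl
Σ<-+ (suc k) f g = trans (cong (_+ (f k + g k)) (Σ<-+ k f g)) (interchange (Σ< k f) (Σ< k g) (f k) (g k))

Σ<-front : ∀ k (f : ℕ → ℕ) → Σ< (suc k) f ≡ f 0 + Σ< k (λ i → f (suc i))
Σ<-front zero    f = +-comm 0 (f 0)
Σ<-front (suc k) f = trans (cong (_+ f (suc k)) (Σ<-front k f)) (+-assoc (f 0) _ _)

Σ<-pairs : ∀ n (g : ℕ → ℕ) → Σ< (2 * n) g ≡ Σ< n (λ j → g (2 * j) + g (suc (2 * j)))
Σ<-pairs zero    g = refl
Σ<-pairs (suc n) g = begin
    Σ< (2 * suc n) g
  ≡⟨ cong (λ m → Σ< m g) (*-suc 2 n) ⟩
    Σ< (2 * n) g + g (2 * n) + g (suc (2 * n))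
  ≡⟨ +-assoc (Σ< (2 * n) g) _ _ ⟩
    Σ< (2 * n) g + (g (2 * n) + g (suc (2 * n)))
  ≡⟨ cong (_+ (g (2 * n) + g (suc (2 * n)))) (Σ<-pairs n g) ⟩
    Σ< (suc n) (λ j → g (2 * j) + g (suc (2 * j)))
  ∎

∸-pred : ∀ {s r} → s < r → r ∸ s ≡ suc (r ∸ suc s)
∸-pred {r = suc r} (s≤s s≤r) = +-∸-assoc 1 s≤r

≈P-sym : ∀ {P Q : Poly} → P ≈P Q → Q ≈P P
≈P-sym eq d = sym (eq d)

⊗-cong : ∀ {P P′ Q Q′ : Poly} → P ≈P P′ → Q ≈P Q′ → (P ⊗ Q) ≈P (P′ ⊗ Q′)
⊗-cong p q d = Σ<-cong (suc d) (λ i _ → cong₂ _*_ (p i) (q (d ∸ i)))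

⊗-congʳ : ∀ (P : Poly) {Q Q′ : Poly} → Q ≈P Q′ → (P ⊗ Q) ≈P (P ⊗ Q′)
⊗-congʳ P = ⊗-cong {P} {P} (λ _ → refl)

⊗-distribʳ-⊕ : ∀ (P Q S : Poly) → ((P ⊕ Q) ⊗ S) ≈P ((P ⊗ S) ⊕ (Q ⊗ S))
⊗-distribʳ-⊕ P Q S d =
  trans (Σ<-cong (suc d) (λ i _ → *-distribʳ-+ (S (d ∸ i)) (P i) (Q i))) (Σ<-+ (suc d) _ _)

qpow-0-⊗ : ∀ (P : Poly) → (qpow 0 ⊗ P) ≈P P
qpow-0-⊗ P d = trans (Σ<-front d _) (trans (cong₂ _+_ (+-identityʳ (P d)) (Σ<-zero d)) (+-identityʳ (P d)))

⟦_⟧ : List ℕ → Poly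
⟦ X ⟧ = countWith (λ a → a) X

_≋_ : List ℕ → List ℕ → Set
X ≋ Y = ⟦ X ⟧ ≈P ⟦ Y ⟧

countWith-map : ∀ {W : Set} (f : W → ℕ) (ws : List W) → countWith f ws ≈P ⟦ map f ws ⟧
countWith-map f []       d = refl
countWith-map f (w ∷ ws) d = cong (_ +_) (countWith-map f ws d)

count-++ : ∀ X Y → ⟦ X ++ Y ⟧ ≈P (⟦ X ⟧ ⊕ ⟦ Y ⟧)
count-++ []      Y d = refl
count-++ (x ∷ X) Y d = trans (cong (_ +_) (count-++ X Y d)) (sym (+-assoc _ (⟦ X ⟧ d) (⟦ Y ⟧ d)))

count-map-suc-0 : ∀ X → ⟦ map suc X ⟧ 0 ≡ 0
count-map-suc-0 []      = refl
count-map-suc-0 (x ∷ X) = count-map-suc-0 X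

count-map-suc : ∀ X d → ⟦ map suc X ⟧ (suc d) ≡ ⟦ X ⟧ d
count-map-suc []      d = refl
count-map-suc (x ∷ X) d = cong (_ +_) (count-map-suc X d)

count-map-+ : ∀ m X → ⟦ map (m +_) X ⟧ ≈P (qpow m ⊗ ⟦ X ⟧)
count-map-+ zero    X d       = trans (cong (λ Y → ⟦ Y ⟧ d) (map-id X)) (sym (qpow-0-⊗ ⟦ X ⟧ d))
count-map-+ (suc m) X zero    = trans (cong (λ Y → ⟦ Y ⟧ 0) (map-∘ X)) (count-map-suc-0 (map (m +_) X))
count-map-+ (suc m) X (suc d) = begin
    ⟦ map (suc m +_) X ⟧ (suc d)
  ≡⟨ cong (λ Y → ⟦ Y ⟧ (suc d)) (map-∘ X) ⟩
    ⟦ map suc (map (m +_) X) ⟧ (suc d)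
  ≡⟨ count-map-suc (map (m +_) X) d ⟩
    ⟦ map (m +_) X ⟧ d
  ≡⟨ count-map-+ m X d ⟩
    (qpow m ⊗ ⟦ X ⟧) d
  ≡⟨ sym (Σ<-front (suc d) _) ⟩
    (qpow (suc m) ⊗ ⟦ X ⟧) (suc d)
  ∎

map-+-+ : ∀ a b X → map (a +_) (map (b +_) X) ≡ map ((a + b) +_) X
map-+-+ a b X = trans (sym (map-∘ X)) (map-cong (λ x → sym (+-assoc a b x)) X)

-- The multiset of sums a + b, a ∈ X, b ∈ Y: areas of a path glued from two
-- independent pieces.  Its generating polynomial is the product.
conv : List ℕ → List ℕ → List ℕ
conv []      Y = []
conv (x ∷ X) Y = map (x +_) Y ++ conv X Y

conv-[]ʳ : ∀ X → conv X [] ≡ []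
conv-[]ʳ []      = refl
conv-[]ʳ (x ∷ X) = conv-[]ʳ X

conv-[0]ʳ : ∀ X → conv X (0 ∷ []) ≡ X
conv-[0]ʳ []      = refl
conv-[0]ʳ (x ∷ X) = cong₂ _∷_ (+-identityʳ x) (conv-[0]ʳ X)

conv-mapʳ : ∀ X w Y → conv X (map (w +_) Y) ≡ map (w +_) (conv X Y)
conv-mapʳ []      w Y = refl
conv-mapʳ (x ∷ X) w Y = begin
    map (x +_) (map (w +_) Y) ++ conv X (map (w +_) Y)
  ≡⟨ cong₂ _++_ (trans (map-+-+ x w Y) (trans (cong (λ c → map (c +_) Y) (+-comm x w)) (sym (map-+-+ w x Y))))
                (conv-mapʳ X w Y) ⟩
    map (w +_) (map (x +_) Y) ++ map (w +_) (conv X Y)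
  ≡⟨ sym (map-++ (w +_) (map (x +_) Y) (conv X Y)) ⟩
    map (w +_) (conv (x ∷ X) Y)
  ∎

conv-mapˡ : ∀ w X Y → conv (map (w +_) X) Y ≡ map (w +_) (conv X Y)
conv-mapˡ w []      Y = refl
conv-mapˡ w (x ∷ X) Y =
  trans (cong₂ _++_ (sym (map-+-+ w x Y)) (conv-mapˡ w X Y)) (sym (map-++ (w +_) (map (x +_) Y) (conv X Y)))

count-conv-++ʳ : ∀ X Y Z → ⟦ conv X (Y ++ Z) ⟧ ≈P (⟦ conv X Y ⟧ ⊕ ⟦ conv X Z ⟧)
count-conv-++ʳ []      Y Z d = refl
count-conv-++ʳ (x ∷ X) Y Z d = begin
    ⟦ map (x +_) (Y ++ Z) ++ conv X (Y ++ Z) ⟧ d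
  ≡⟨ count-++ (map (x +_) (Y ++ Z)) _ d ⟩
    ⟦ map (x +_) (Y ++ Z) ⟧ d + ⟦ conv X (Y ++ Z) ⟧ d
  ≡⟨ cong₂ _+_ (trans (cong (λ W → ⟦ W ⟧ d) (map-++ (x +_) Y Z)) (count-++ (map (x +_) Y) (map (x +_) Z) d))
               (count-conv-++ʳ X Y Z d) ⟩
    (⟦ map (x +_) Y ⟧ d + ⟦ map (x +_) Z ⟧ d) + (⟦ conv X Y ⟧ d + ⟦ conv X Z ⟧ d)
  ≡⟨ interchange (⟦ map (x +_) Y ⟧ d) (⟦ map (x +_) Z ⟧ d) (⟦ conv X Y ⟧ d) (⟦ conv X Z ⟧ d) ⟩
    (⟦ map (x +_) Y ⟧ d + ⟦ conv X Y ⟧ d) + (⟦ map (x +_) Z ⟧ d + ⟦ conv X Z ⟧ d)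
  ≡⟨ sym (cong₂ _+_ (count-++ (map (x +_) Y) _ d) (count-++ (map (x +_) Z) _ d)) ⟩
    ⟦ conv (x ∷ X) Y ⟧ d + ⟦ conv (x ∷ X) Z ⟧ d
  ∎

count-conv : ∀ X Y → ⟦ conv X Y ⟧ ≈P (⟦ X ⟧ ⊗ ⟦ Y ⟧)
count-conv []      Y d = sym (Σ<-zero (suc d))
count-conv (x ∷ X) Y d = begin
    ⟦ map (x +_) Y ++ conv X Y ⟧ d
  ≡⟨ count-++ (map (x +_) Y) (conv X Y) d ⟩
    ⟦ map (x +_) Y ⟧ d + ⟦ conv X Y ⟧ d
  ≡⟨ cong₂ _+_ (count-map-+ x Y d) (count-conv X Y d) ⟩
    (qpow x ⊗ ⟦ Y ⟧) d + (⟦ X ⟧ ⊗ ⟦ Y ⟧) d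
  ≡⟨ sym (⊗-distribʳ-⊕ (qpow x) ⟦ X ⟧ ⟦ Y ⟧ d) ⟩
    (⟦ x ∷ X ⟧ ⊗ ⟦ Y ⟧) d
  ∎

count-conv-shift : ∀ m X Y → ⟦ conv (map (m +_) X) Y ⟧ ≈P (qpow m ⊗ (⟦ X ⟧ ⊗ ⟦ Y ⟧))
count-conv-shift m X Y d = begin
    ⟦ conv (map (m +_) X) Y ⟧ d
  ≡⟨ cong (λ W → ⟦ W ⟧ d) (conv-mapˡ m X Y) ⟩
    ⟦ map (m +_) (conv X Y) ⟧ d
  ≡⟨ count-map-+ m (conv X Y) d ⟩
    (qpow m ⊗ ⟦ conv X Y ⟧) d
  ≡⟨ ⊗-congʳ (qpow m) (count-conv X Y) d ⟩
    (qpow m ⊗ (⟦ X ⟧ ⊗ ⟦ Y ⟧)) d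
  ∎

concat< : ℕ → (ℕ → List ℕ) → List ℕ
concat< zero    F = []
concat< (suc k) F = concat< k F ++ F k

count-concat< : ∀ k F d → ⟦ concat< k F ⟧ d ≡ Σ< k (λ i → ⟦ F i ⟧ d)
count-concat< zero    F d = refl
count-concat< (suc k) F d = trans (count-++ (concat< k F) (F k) d) (cong (_+ ⟦ F k ⟧ d) (count-concat< k F d))

-- Families of paths indexed by the current height h and the number r of
-- remaining steps, described by their area multisets

-- The continuation after an E step from height h (none from height 0).
below : {X : Set} → (ℕ → List X) → ℕ → List X
below F zero    = []
below F (suc h) = F h

-- Paths taking a first step from height h: an N step of area w followed by a
-- path of F from height h + 1, or an E step followed by a path of F from h - 1.
step : ℕ → ℕ → (ℕ → List ℕ) → List ℕ
step h w F = map (w +_) (F (suc h)) ++ below F h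

-- Type B areas: all paths staying weakly above the diagonal; the N step with
-- r steps to go has area h ⊓ r.
B : ℕ → ℕ → List ℕ
B h zero    = 0 ∷ []
B h (suc r) = step h (h ⊓ suc r) (λ k → B k r)

-- Type A areas of paths ending at height e; the N step has area h.
A : ℕ → ℕ → ℕ → List ℕ
A e h zero    = if e ≡ᵇ h then 0 ∷ [] else []
A e h (suc r) = step h h (λ k → A e k r)

-- Type B areas of the paths that stay at height ≥ 2.
H₂ : ℕ → ℕ → List ℕ
H₂ zero             r       = []
H₂ (suc zero)       r       = []
H₂ (suc (suc h))    zero    = 0 ∷ []
H₂ (suc (suc h))    (suc r) = step (suc (suc h)) (suc (suc h) ⊓ suc r) (λ k → H₂ k r)

-- Areas of what follows a last visit to height 1 with s + 1 steps to go:
-- an N step (area 1 ⊓ (s + 1) = 1), then s steps at height ≥ 2.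
Tail : ℕ → List ℕ
Tail s = map suc (H₂ 2 s)

-- Paths from h whose last visit to height 1 has s + 1 steps to go, s < r.
U : ℕ → ℕ → List ℕ
U h r = concat< r (λ s → conv (Tail s) (A 1 h (r ∸ suc s)))

R : ℕ → ℕ → List ℕ
R h r = A 0 h r ++ A 1 h r ++ U h r ++ H₂ h r

below-cong : ∀ {X : Set} {F G : ℕ → List X} → (∀ k → F k ≡ G k) → ∀ h → below F h ≡ below G h
below-cong eq zero    = refl
below-cong eq (suc h) = eq h

below-++ : ∀ (F G : ℕ → List ℕ) h → below (λ k → F k ++ G k) h ≡ below F h ++ below G h
below-++ F G zero    = refl
below-++ F G (suc h) = refl

step-[] : ∀ h w → step h w (λ _ → []) ≡ []
step-[] zero    w = refl
step-[] (suc h) w = refl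

count-step-++ : ∀ h w (F G : ℕ → List ℕ) d →
  ⟦ step h w (λ k → F k ++ G k) ⟧ d ≡ ⟦ step h w F ⟧ d + ⟦ step h w G ⟧ d
count-step-++ h w F G d = begin
    ⟦ map (w +_) (F (suc h) ++ G (suc h)) ++ below (λ k → F k ++ G k) h ⟧ d
  ≡⟨ count-++ (map (w +_) (F (suc h) ++ G (suc h))) _ d ⟩
    ⟦ map (w +_) (F (suc h) ++ G (suc h)) ⟧ d + ⟦ below (λ k → F k ++ G k) h ⟧ d
  ≡⟨ cong₂ _+_ (trans (cong (λ X → ⟦ X ⟧ d) (map-++ (w +_) (F (suc h)) (G (suc h)))) (count-++ (map (w +_) (F (suc h))) (map (w +_) (G (suc h))) d))
               (trans (cong (λ X → ⟦ X ⟧ d) (below-++ F G h)) (count-++ (below F h) (below G h) d)) ⟩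
    (⟦ map (w +_) (F (suc h)) ⟧ d + ⟦ map (w +_) (G (suc h)) ⟧ d) + (⟦ below F h ⟧ d + ⟦ below G h ⟧ d)
  ≡⟨ interchange (⟦ map (w +_) (F (suc h)) ⟧ d) (⟦ map (w +_) (G (suc h)) ⟧ d) (⟦ below F h ⟧ d) (⟦ below G h ⟧ d) ⟩
    (⟦ map (w +_) (F (suc h)) ⟧ d + ⟦ below F h ⟧ d) + (⟦ map (w +_) (G (suc h)) ⟧ d + ⟦ below G h ⟧ d)
  ≡⟨ sym (cong₂ _+_ (count-++ (map (w +_) (F (suc h))) _ d) (count-++ (map (w +_) (G (suc h))) _ d)) ⟩
    ⟦ step h w F ⟧ d + ⟦ step h w G ⟧ d
  ∎

-- step respects ≋, so equal one-step recursions give equal multisets.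
step-≋ : ∀ h w {F G : ℕ → List ℕ} → (∀ k → F k ≋ G k) → step h w F ≋ step h w G
step-≋ h w {F} {G} eq d = begin
    ⟦ map (w +_) (F (suc h)) ++ below F h ⟧ d
  ≡⟨ count-++ (map (w +_) (F (suc h))) _ d ⟩
    ⟦ map (w +_) (F (suc h)) ⟧ d + ⟦ below F h ⟧ d
  ≡⟨ cong₂ _+_ shifted (below-≋ h) ⟩
    ⟦ map (w +_) (G (suc h)) ⟧ d + ⟦ below G h ⟧ d
  ≡⟨ sym (count-++ (map (w +_) (G (suc h))) _ d) ⟩
    ⟦ map (w +_) (G (suc h)) ++ below G h ⟧ d
  ∎
  where
  shifted : ⟦ map (w +_) (F (suc h)) ⟧ d ≡ ⟦ map (w +_) (G (suc h)) ⟧ d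
  shifted = trans (count-map-+ w (F (suc h)) d)
                  (trans (⊗-congʳ (qpow w) (eq (suc h)) d) (sym (count-map-+ w (G (suc h)) d)))
  below-≋ : ∀ h → ⟦ below F h ⟧ d ≡ ⟦ below G h ⟧ d
  below-≋ zero    = refl
  below-≋ (suc h) = eq h d

conv-step : ∀ V h w (F : ℕ → List ℕ) d → ⟦ conv V (step h w F) ⟧ d ≡ ⟦ step h w (λ k → conv V (F k)) ⟧ d
conv-step V h w F d = begin
    ⟦ conv V (map (w +_) (F (suc h)) ++ below F h) ⟧ d
  ≡⟨ count-conv-++ʳ V (map (w +_) (F (suc h))) (below F h) d ⟩
    ⟦ conv V (map (w +_) (F (suc h))) ⟧ d + ⟦ conv V (below F h) ⟧ d
  ≡⟨ cong₂ (λ X Y → ⟦ X ⟧ d + ⟦ Y ⟧ d) (conv-mapʳ V w (F (suc h))) (conv-below h) ⟩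
    ⟦ map (w +_) (conv V (F (suc h))) ⟧ d + ⟦ below (λ k → conv V (F k)) h ⟧ d
  ≡⟨ sym (count-++ (map (w +_) (conv V (F (suc h)))) _ d) ⟩
    ⟦ step h w (λ k → conv V (F k)) ⟧ d
  ∎
  where
  conv-below : ∀ h → conv V (below F h) ≡ below (λ k → conv V (F k)) h
  conv-below zero    = conv-[]ʳ V
  conv-below (suc h) = refl

step-concat< : ∀ h w r (F : ℕ → ℕ → List ℕ) d →
  ⟦ step h w (λ k → concat< r (F k)) ⟧ d ≡ Σ< r (λ s → ⟦ step h w (λ k → F k s) ⟧ d)
step-concat< h w zero    F d = cong (λ X → ⟦ X ⟧ d) (step-[] h w)
step-concat< h w (suc r) F d =
  trans (count-step-++ h w (λ k → concat< r (F k)) (λ k → F k r) d) (cong (_+ ⟦ step h w (λ k → F k r) ⟧ d) (step-concat< h w r F d))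

A-refl : ∀ h → A h h 0 ≡ 0 ∷ []
A-refl zero    = refl
A-refl (suc h) = A-refl h

A-≢ : ∀ e h → e ≢ h → A e h 0 ≡ []
A-≢ e h e≢h with e ≡ᵇ h in eq
... | true  = ⊥-elim (e≢h (≡ᵇ⇒≡ e h (subst T (sym eq) tt)))
... | false = refl

A-empty : ∀ r e h → e + r < h → A e h r ≡ []
A-empty zero    e h lt = A-≢ e h (λ e≡h → n≮n h (subst (_< h) (trans (+-identityʳ e) e≡h) lt))
A-empty (suc r) e h lt =
  cong₂ _++_ (cong (map (h +_)) (A-empty r e (suc h) (m<n⇒m<1+n (<-trans (+-monoʳ-< e (n<1+n r)) lt))))
             (down h lt)
  where
  down : ∀ h → e + suc r < h → below (λ k → A e k r) h ≡ []
  down zero    _  = refl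
  down (suc k) lt = A-empty r e k (≤-pred (subst (_< suc k) (+-suc e r) lt))

-- A path from height h + 1 reaching height e within j steps has h ≤ e + j, so
-- when e + j ≤ t the truncated area h ⊓ t of the N step leading to it is h.
A-trunc : ∀ e h j t → e + j ≤ t → A e h (suc j) ≡ step h (h ⊓ t) (λ k → A e k j)
A-trunc e h j t le with h ≤? t
... | yes h≤t = cong (λ w → step h w (λ k → A e k j)) (sym (m≤n⇒m⊓n≡m h≤t))
... | no  h≰t rewrite A-empty j e (suc h) (s≤s (≤-trans le (<⇒≤ (≰⇒> h≰t)))) = refl

-- A path ending at height 0 ends with an E step from height 1 (adding no area).
A-last : ∀ r h → A 0 h (suc r) ≡ A 1 h r
A-last zero    zero          = refl
A-last zero    (suc zero)    = refl
A-last zero    (suc (suc h)) = refl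
A-last (suc r) h = cong₂ _++_ (cong (map (h +_)) (A-last r (suc h))) (below-cong (λ k → A-last r k) h)

parity-double : ∀ h → parity (h + h + 0) ≡ 0ℙ
parity-double h = trans (cong parity (+-identityʳ (h + h))) (trans (parity-+ h h) (p+p≡0ℙ (parity h)))

parity-odd : ∀ j → parity (suc (2 * j)) ≡ 1ℙ
parity-odd j = trans (parity-+ 1 (2 * j)) (cong (1ℙ ℙ.+_) (parity-* 2 j))

A-odd : ∀ r e h → parity (e + h + r) ≡ 1ℙ → A e h r ≡ []
A-odd zero    e h odd = A-≢ e h e≢h
  where
  e≢h : e ≢ h
  e≢h refl with () ← trans (sym (parity-double e)) odd
A-odd (suc r) e h odd =
  cong₂ _++_ (cong (map (h +_)) (A-odd r e (suc h) (trans (cong parity north) odd))) (down h odd)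
  where
  north : e + suc h + r ≡ e + h + suc r
  north = trans (cong (_+ r) (+-suc e h)) (sym (+-suc (e + h) r))
  down : ∀ h → parity (e + h + suc r) ≡ 1ℙ → below (λ k → A e k r) h ≡ []
  down zero    _   = refl
  down (suc k) odd =
    A-odd r e k (trans (sym (cong parity (trans (+-suc (e + suc k) r) (cong (λ m → suc (m + r)) (+-suc e k))))) odd)

-- The N-step areas of a path raised by two exceed the original ones by
-- (r ∸ h) in total; this is the one-step identity behind it.
raise-weight : ∀ h r → suc (suc h) ⊓ suc r + (r ∸ suc h) ≡ (suc r ∸ h) + h ⊓ suc r
raise-weight zero    zero    = refl
raise-weight zero    (suc r) = sym (+-identityʳ (suc (suc r)))
raise-weight (suc h) zero    = sym (cong₂ _+_ (0∸n≡0 h) (cong suc (⊓-zeroʳ h)))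
raise-weight (suc h) (suc r) = trans (cong suc (raise-weight h r)) (sym (+-suc (suc r ∸ h) (h ⊓ suc r)))

H₂-raise : ∀ r h → H₂ (suc (suc h)) r ≡ map ((r ∸ h) +_) (B h r)
H₂-raise zero    h = cong (_∷ []) (sym (trans (+-identityʳ (0 ∸ h)) (0∸n≡0 h)))
H₂-raise (suc r) h = begin
    map ((suc (suc h) ⊓ suc r) +_) (H₂ (suc (suc (suc h))) r) ++ H₂ (suc h) r
  ≡⟨ cong₂ _++_ (cong (map _) (H₂-raise r (suc h))) (down h) ⟩
    map ((suc (suc h) ⊓ suc r) +_) (map ((r ∸ suc h) +_) (B (suc h) r))
      ++ map ((suc r ∸ h) +_) (below (λ k → B k r) h)
  ≡⟨ cong (_++ map ((suc r ∸ h) +_) (below (λ k → B k r) h)) (trans (map-+-+ (suc (suc h) ⊓ suc r) (r ∸ suc h) (B (suc h) r))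
       (trans (cong (λ c → map (c +_) (B (suc h) r)) (raise-weight h r))
              (sym (map-+-+ (suc r ∸ h) (h ⊓ suc r) (B (suc h) r))))) ⟩
    map ((suc r ∸ h) +_) (map ((h ⊓ suc r) +_) (B (suc h) r)) ++ map ((suc r ∸ h) +_) (below (λ k → B k r) h)
  ≡⟨ sym (map-++ ((suc r ∸ h) +_) (map ((h ⊓ suc r) +_) (B (suc h) r)) _) ⟩
    map ((suc r ∸ h) +_) (B h (suc r))
  ∎
  where
  down : ∀ h → H₂ (suc h) r ≡ map ((suc r ∸ h) +_) (below (λ k → B k r) h)
  down zero    = refl
  down (suc k) = H₂-raise r k

above? : (h : ℕ) → Decidable (λ w → aboveDiag h w ≡ true)
above? h w = aboveDiag h w 𝔹.≟ true

north? : (c : ℕ) → Decidable (λ w → countN w ≡ c)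
north? c w = countN w ℕ.≟ c

paths : ℕ → ℕ → List (List Step)
paths h M = filter (above? h) (words M)

paths# : ℕ → ℕ → ℕ → List (List Step)
paths# h c M = filter (north? c) (paths h M)

filter-map : ∀ {X Y : Set} {ℓ₁ ℓ₂ : Level} {P : Pred Y ℓ₁} {Q : Pred X ℓ₂}
  (P? : Decidable P) (Q? : Decidable Q) (f : X → Y) →
  (∀ x → does (P? (f x)) ≡ does (Q? x)) → ∀ xs → filter P? (map f xs) ≡ map f (filter Q? xs)
filter-map P? Q? f agree []       = refl
filter-map P? Q? f agree (x ∷ xs) with does (P? (f x)) | does (Q? x) | agree x
... | true  | true  | _ = cong (f x ∷_) (filter-map P? Q? f agree xs)
... | false | false | _ = filter-map P? Q? f agree xs

filter-map-none : ∀ {X Y : Set} {ℓ : Level} {P : Pred Y ℓ} (P? : Decidable P) (f : X → Y) →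
  (∀ x → does (P? (f x)) ≡ false) → ∀ xs → filter P? (map f xs) ≡ []
filter-map-none P? f reject []       = refl
filter-map-none P? f reject (x ∷ xs) with does (P? (f x)) | reject x
... | false | _ = filter-map-none P? f reject xs

paths-suc : ∀ h M → paths h (suc M) ≡ map (N ∷_) (paths (suc h) M) ++ below (λ k → map (E ∷_) (paths k M)) h
paths-suc h M = trans (filter-++ (above? h) (map (N ∷_) (words M)) (map (E ∷_) (words M)))
  (cong₂ _++_ (filter-map (above? h) (above? (suc h)) (N ∷_) (λ _ → refl) (words M)) (down h))
  where
  down : ∀ h → filter (above? h) (map (E ∷_) (words M)) ≡ below (λ k → map (E ∷_) (paths k M)) h
  down zero    = filter-map-none (above? 0) (E ∷_) (λ _ → refl) (words M)
  down (suc k) = filter-map (above? (suc k)) (above? k) (E ∷_) (λ _ → refl) (words M)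

northFirst : ℕ → ℕ → ℕ → List (List Step)
northFirst h zero    M = []
northFirst h (suc c) M = map (N ∷_) (paths# (suc h) c M)

paths#-suc : ∀ h c M → paths# h c (suc M) ≡ northFirst h c M ++ below (λ k → map (E ∷_) (paths# k c M)) h
paths#-suc h c M = trans (cong (filter (north? c)) (paths-suc h M))
  (trans (filter-++ (north? c) (map (N ∷_) (paths (suc h) M)) _) (cong₂ _++_ (up c) (down h)))
  where
  up : ∀ c → filter (north? c) (map (N ∷_) (paths (suc h) M)) ≡ northFirst h c M
  up zero    = filter-map-none (north? 0) (N ∷_) (λ _ → refl) (paths (suc h) M)
  up (suc c) = filter-map (north? (suc c)) (north? c) (N ∷_) (λ _ → refl) (paths (suc h) M)
  down : ∀ h → filter (north? c) (below (λ k → map (E ∷_) (paths k M)) h)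
               ≡ below (λ k → map (E ∷_) (paths# k c M)) h
  down zero    = refl
  down (suc k) = filter-map (north? c) (north? c) (E ∷_) (λ _ → refl) (paths k M)

countRange-below : ∀ k lo t (p : ℕ → Bool) → (∀ a → T (p a) → a < t) → (∀ a → a < t → T (p a)) →
  countRange lo k p ≡ k ⊓ (t ∸ lo)
countRange-below zero    lo t p sound complete = refl
countRange-below (suc k) lo t p sound complete with p lo in eq | lo <? t
... | true  | yes lo<t = trans (cong suc (countRange-below k (suc lo) t p sound complete))
                              (cong (suc k ⊓_) (sym (∸-pred lo<t)))
... | false | no  lo≮t = trans (countRange-below k (suc lo) t p sound complete)
                              (trans (cong (k ⊓_) (m≤n⇒m∸n≡0 (≤-trans t≤lo (n≤1+n lo))))
                                     (trans (⊓-zeroʳ k) (cong (suc k ⊓_) (sym (m≤n⇒m∸n≡0 t≤lo)))))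
  where
  t≤lo : t ≤ lo
  t≤lo = ≮⇒≥ lo≮t
... | true  | no  lo≮t = ⊥-elim (lo≮t (sound lo (subst T (sym eq) tt)))
... | false | yes lo<t = ⊥-elim (subst T eq (complete lo lo<t))

countRange-all : ∀ k lo → countRange lo k (λ _ → true) ≡ k
countRange-all zero    lo = refl
countRange-all (suc k) lo = cong suc (countRange-all k (suc lo))

area-north : ∀ {ok : ℕ → ℕ → Bool} x y w (X : List (List Step)) →
  countRange x (y ∸ x) (λ a → ok a y) ≡ w →
  map (areaWith ok x y) (map (N ∷_) X) ≡ map (w +_) (map (areaWith ok x (suc y)) X)
area-north {ok} x y w X eq =
  trans (sym (map-∘ X)) (trans (map-cong (λ v → cong (_+ areaWith ok x (suc y) v) eq) X) (map-∘ X))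

okB : ℕ → ℕ → ℕ → Bool
okB t a b = suc (a + b) ≤ᵇ t

B-weight : ∀ t M x h → x + (x + h) + suc M ≡ t →
  countRange x ((x + h) ∸ x) (λ a → okB t a (x + h)) ≡ h ⊓ suc M
B-weight t M x h tot = begin
    countRange x ((x + h) ∸ x) (λ a → okB t a y)
  ≡⟨ cong (λ k → countRange x k (λ a → okB t a y)) (m+n∸m≡n x h) ⟩
    countRange x h (λ a → okB t a y)
  ≡⟨ countRange-below h x (x + suc M) (λ a → okB t a y) sound complete ⟩
    h ⊓ ((x + suc M) ∸ x)
  ≡⟨ cong (h ⊓_) (m+n∸m≡n x (suc M)) ⟩
    h ⊓ suc M
  ∎
  where
  y = x + h
  split : t ≡ x + suc M + y
  split = trans (sym tot) (swap x y (suc M))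
    where
    swap : ∀ a b c → a + b + c ≡ a + c + b
    swap = solve-∀
  sound : ∀ a → T (okB t a y) → a < x + suc M
  sound a ok = +-cancelʳ-< y a (x + suc M) (subst (suc (a + y) ≤_) split (≤ᵇ⇒≤ (suc (a + y)) t ok))
  complete : ∀ a → a < x + suc M → T (okB t a y)
  complete a lt = ≤⇒≤ᵇ (subst (suc (a + y) ≤_) (sym split) (+-monoˡ-< y lt))

link-B : ∀ t M x y h → y ≡ x + h → x + y + M ≡ t → map (areaWith (okB t) x y) (paths h M) ≡ B h M
link-B t zero    x y h _ _ = refl
link-B t (suc M) x .(x + h) h refl tot = begin
    map area (paths h (suc M))
  ≡⟨ cong (map area) (paths-suc h M) ⟩
    map area (map (N ∷_) (paths (suc h) M) ++ below (λ k → map (E ∷_) (paths k M)) h)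
  ≡⟨ map-++ area (map (N ∷_) (paths (suc h) M)) _ ⟩
    map area (map (N ∷_) (paths (suc h) M)) ++ map area (below (λ k → map (E ∷_) (paths k M)) h)
  ≡⟨ cong₂ _++_ north (south h tot) ⟩
    step h (h ⊓ suc M) (λ k → B k M)
  ∎
  where
  area = areaWith (okB t) x (x + h)
  north : map area (map (N ∷_) (paths (suc h) M)) ≡ map ((h ⊓ suc M) +_) (B (suc h) M)
  north = trans (area-north x (x + h) (h ⊓ suc M) (paths (suc h) M) (B-weight t M x h tot))
    (cong (map ((h ⊓ suc M) +_)) (link-B t M x (suc (x + h)) (suc h) (sym (+-suc x h))
      (trans (trans (cong (_+ M) (+-suc x (x + h))) (sym (+-suc (x + (x + h)) M))) tot)))
  south : ∀ h → x + (x + h) + suc M ≡ t →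
    map (areaWith (okB t) x (x + h)) (below (λ k → map (E ∷_) (paths k M)) h) ≡ below (λ k → B k M) h
  south zero    _   = refl
  south (suc k) tot = trans (sym (map-∘ (paths k M)))
    (link-B t M (suc x) (x + suc k) k (+-suc x k) (trans (sym (+-suc (x + (x + suc k)) M)) tot))

-- Dyck-type paths from (x, y) at height h with c north steps among M, which
-- therefore end at height e = h + 2c - M, give exactly the list A e h M.
link-A : ∀ M c x y h e → y ≡ x + h → e + M ≡ h + c + c →
  map (areaWith (λ _ _ → true) x y) (paths# h c M) ≡ A e h M
link-A zero zero    x y h e _ eq = sym (trans (cong (λ e → A e h 0) e≡h) (A-refl h))
  where
  e≡h : e ≡ h
  e≡h = trans (sym (+-identityʳ e)) (trans eq (trans (+-identityʳ (h + 0)) (+-identityʳ h)))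
link-A zero (suc c) x y h e _ eq = sym (A-≢ e h e≢h)
  where
  e≢h : e ≢ h
  e≢h refl with () ← +-cancelˡ-≡ e 0 (suc c + suc c) (trans eq (+-assoc e (suc c) (suc c)))
link-A (suc M) c x .(x + h) h e refl eq = begin
    map area (paths# h c (suc M))
  ≡⟨ cong (map area) (paths#-suc h c M) ⟩
    map area (northFirst h c M ++ below (λ k → map (E ∷_) (paths# k c M)) h)
  ≡⟨ map-++ area (northFirst h c M) _ ⟩
    map area (northFirst h c M) ++ map area (below (λ k → map (E ∷_) (paths# k c M)) h)
  ≡⟨ cong₂ _++_ (north c eq) (south h eq) ⟩
    step h h (λ k → A e k M)
  ∎
  where
  area = areaWith (λ _ _ → true) x (x + h)
  north : ∀ c → e + suc M ≡ h + c + c → map area (northFirst h c M) ≡ map (h +_) (A e (suc h) M)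
  north zero    eq = sym (cong (map (h +_)) (A-empty M e (suc h) (m<n⇒m<1+n (≤-reflexive
    (trans (sym (+-suc e M)) (trans eq (trans (+-identityʳ (h + 0)) (+-identityʳ h))))))))
  north (suc c) eq =
    trans (area-north x (x + h) h (paths# (suc h) c M) (trans (countRange-all _ x) (m+n∸m≡n x h)))
      (cong (map (h +_)) (link-A M c x (suc (x + h)) (suc h) e (sym (+-suc x h))
        (suc-injective (trans (sym (+-suc e M)) (trans eq (shuffle h c))))))
    where
    shuffle : ∀ h c → h + suc c + suc c ≡ suc (suc h + c + c)
    shuffle = solve-∀
  south : ∀ h → e + suc M ≡ h + c + c →
    map (areaWith (λ _ _ → true) x (x + h)) (below (λ k → map (E ∷_) (paths# k c M)) h)
      ≡ below (λ k → A e k M) h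
  south zero    _  = refl
  south (suc k) eq = trans (sym (map-∘ (paths# k c M)))
    (link-A M c (suc x) (x + suc k) k e (+-suc x k) (suc-injective (trans (sym (+-suc e M)) eq)))

CatB-count : ∀ n → CatB n ≈P ⟦ B 0 (2 * n) ⟧
CatB-count zero    zero    = refl
CatB-count zero    (suc d) = refl
CatB-count (suc n) d = trans (countWith-map (areaB (suc n)) (catBPaths (suc n)) d)
  (cong (λ X → ⟦ X ⟧ d) (link-B (2 * suc n) (2 * suc n) 0 0 0 refl refl))

Cat-count : ∀ c → Cat c ≈P ⟦ A 0 0 (2 * c) ⟧
Cat-count zero    zero    = refl
Cat-count zero    (suc d) = refl
Cat-count (suc c) d = trans (countWith-map areaA (catPaths (suc c)) d)
  (cong (λ X → ⟦ X ⟧ d) (link-A (2 * suc c) (suc c) 0 0 0 0 refl (cong (suc c +_) (+-identityʳ (suc c)))))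

-- One step of a path staying at height ≥ 2: from height 1 the N step starts
-- a tail (the last visit to height 1 is now), otherwise it continues H₂.
H₂-step : ∀ h r → step h (h ⊓ suc r) (λ k → H₂ k r) ≡ conv (Tail r) (A 1 h 0) ++ H₂ h (suc r)
H₂-step zero          r = sym (cong (_++ []) (conv-[]ʳ (Tail r)))
H₂-step (suc zero)    r = cong (_++ []) (sym (conv-[0]ʳ (Tail r)))
H₂-step (suc (suc h)) r = sym (cong (_++ H₂ (suc (suc h)) (suc r)) (conv-[]ʳ (Tail r)))

-- Splitting off the first step of U: either the last visit to height 1 is
-- right now (only possible from height 1), or it comes later.
U-step : ∀ h r d →
  ⟦ U h (suc r) ⟧ d ≡ ⟦ step h (h ⊓ suc r) (λ k → U k r) ⟧ d + ⟦ conv (Tail r) (A 1 h 0) ⟧ d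
U-step h r d = begin
    ⟦ concat< r (λ s → conv (Tail s) (A 1 h (r ∸ s))) ++ conv (Tail r) (A 1 h (r ∸ r)) ⟧ d
  ≡⟨ count-++ (concat< r (λ s → conv (Tail s) (A 1 h (r ∸ s)))) _ d ⟩
    ⟦ concat< r (λ s → conv (Tail s) (A 1 h (r ∸ s))) ⟧ d + ⟦ conv (Tail r) (A 1 h (r ∸ r)) ⟧ d
  ≡⟨ cong₂ _+_ (count-concat< r _ d) (cong (λ j → ⟦ conv (Tail r) (A 1 h j) ⟧ d) (n∸n≡0 r)) ⟩
    Σ< r (λ s → ⟦ conv (Tail s) (A 1 h (r ∸ s)) ⟧ d) + ⟦ conv (Tail r) (A 1 h 0) ⟧ d
  ≡⟨ cong (_+ ⟦ conv (Tail r) (A 1 h 0) ⟧ d) (Σ<-cong r later) ⟩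
    Σ< r (λ s → ⟦ step h m (λ k → conv (Tail s) (A 1 k (r ∸ suc s))) ⟧ d) + ⟦ conv (Tail r) (A 1 h 0) ⟧ d
  ≡⟨ cong (_+ ⟦ conv (Tail r) (A 1 h 0) ⟧ d) (sym (step-concat< h m r (λ k s → conv (Tail s) (A 1 k (r ∸ suc s))) d)) ⟩
    ⟦ step h m (λ k → U k r) ⟧ d + ⟦ conv (Tail r) (A 1 h 0) ⟧ d
  ∎
  where
  m = h ⊓ suc r
  later : ∀ s → s < r →
    ⟦ conv (Tail s) (A 1 h (r ∸ s)) ⟧ d ≡ ⟦ step h m (λ k → conv (Tail s) (A 1 k (r ∸ suc s))) ⟧ d
  later s s<r = trans
    (cong (λ X → ⟦ conv (Tail s) X ⟧ d)
      (trans (cong (A 1 h) (∸-pred s<r)) (A-trunc 1 h (r ∸ suc s) (suc r) (s≤s (m∸n≤m r (suc s))))))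
    (conv-step (Tail s) h m (λ k → A 1 k (r ∸ suc s)) d)

count-++₄ : ∀ W X Y Z d → ⟦ W ++ X ++ Y ++ Z ⟧ d ≡ ⟦ W ⟧ d + (⟦ X ⟧ d + (⟦ Y ⟧ d + ⟦ Z ⟧ d))
count-++₄ W X Y Z d =
  trans (count-++ W (X ++ Y ++ Z) d) (cong (⟦ W ⟧ d +_) (trans (count-++ X (Y ++ Z) d) (cong (⟦ X ⟧ d +_) (count-++ Y Z d))))

R-base : ∀ h → R h 0 ≡ 0 ∷ []
R-base zero          = refl
R-base (suc zero)    = refl
R-base (suc (suc h)) = refl

R-step : ∀ h r → step h (h ⊓ suc r) (λ k → R k r) ≋ R h (suc r)
R-step h r d = begin
    ⟦ step h m (λ k → A 0 k r ++ A 1 k r ++ U k r ++ H₂ k r) ⟧ d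
  ≡⟨ count-step-++ h m (λ k → A 0 k r) _ d ⟩
    S₀ + ⟦ step h m (λ k → A 1 k r ++ U k r ++ H₂ k r) ⟧ d
  ≡⟨ cong (S₀ +_) (count-step-++ h m (λ k → A 1 k r) _ d) ⟩
    S₀ + (S₁ + ⟦ step h m (λ k → U k r ++ H₂ k r) ⟧ d)
  ≡⟨ cong (λ z → S₀ + (S₁ + z)) (count-step-++ h m (λ k → U k r) (λ k → H₂ k r) d) ⟩
    S₀ + (S₁ + (SU + ⟦ step h m (λ k → H₂ k r) ⟧ d))
  ≡⟨ cong (λ z → S₀ + (S₁ + (SU + z))) (trans (cong (λ X → ⟦ X ⟧ d) (H₂-step h r)) (count-++ (conv (Tail r) (A 1 h 0)) _ d)) ⟩
    S₀ + (S₁ + (SU + (T₁ + ⟦ H₂ h (suc r) ⟧ d)))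
  ≡⟨ cong (λ z → S₀ + (S₁ + z)) (sym (+-assoc SU T₁ _)) ⟩
    S₀ + (S₁ + (SU + T₁ + ⟦ H₂ h (suc r) ⟧ d))
  ≡⟨ cong₂ (λ a b → a + (b + (SU + T₁ + ⟦ H₂ h (suc r) ⟧ d))) (sym (A-count 0 (n≤1+n r))) (sym (A-count 1 ≤-refl)) ⟩
    ⟦ A 0 h (suc r) ⟧ d + (⟦ A 1 h (suc r) ⟧ d + (SU + T₁ + ⟦ H₂ h (suc r) ⟧ d))
  ≡⟨ cong (λ z → ⟦ A 0 h (suc r) ⟧ d + (⟦ A 1 h (suc r) ⟧ d + (z + ⟦ H₂ h (suc r) ⟧ d))) (sym (U-step h r d)) ⟩
    ⟦ A 0 h (suc r) ⟧ d + (⟦ A 1 h (suc r) ⟧ d + (⟦ U h (suc r) ⟧ d + ⟦ H₂ h (suc r) ⟧ d))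
  ≡⟨ sym (count-++₄ (A 0 h (suc r)) (A 1 h (suc r)) (U h (suc r)) (H₂ h (suc r)) d) ⟩
    ⟦ R h (suc r) ⟧ d
  ∎
  where
  m  = h ⊓ suc r
  S₀ = ⟦ step h m (λ k → A 0 k r) ⟧ d
  S₁ = ⟦ step h m (λ k → A 1 k r) ⟧ d
  SU = ⟦ step h m (λ k → U k r) ⟧ d
  T₁ = ⟦ conv (Tail r) (A 1 h 0) ⟧ d
  A-count : ∀ e → e + r ≤ suc r → ⟦ A e h (suc r) ⟧ d ≡ ⟦ step h m (λ k → A e k r) ⟧ d
  A-count e le = cong (λ X → ⟦ X ⟧ d) (A-trunc e h r (suc r) le)

B≋R : ∀ r h → B h r ≋ R h r
B≋R zero    h d = cong (λ X → ⟦ X ⟧ d) (sym (R-base h))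
B≋R (suc r) h d = trans (step-≋ h (h ⊓ suc r) {λ k → B k r} {λ k → R k r} (λ k → B≋R r k) d) (R-step h r d)

-- A tail of even length 2k is an N step followed by a type B path of length
-- 2k raised by two, of total extra area 2k + 1.
Tail-even : ∀ k → Tail (2 * k) ≡ map ((2 * k + 1) +_) (B 0 (2 * k))
Tail-even k = trans (cong (map suc) (H₂-raise (2 * k) 0))
  (trans (map-+-+ 1 (2 * k) (B 0 (2 * k))) (cong (λ c → map (c +_) (B 0 (2 * k))) (+-comm 1 (2 * k))))

-- The classes U 0 (2n): last visit to height 1 with 2k + 1 steps to go.
U-origin : ∀ n d → ⟦ U 0 (2 * n) ⟧ d ≡ Σ< n (λ k → (qpow (2 * k + 1) ⊗ (CatB k ⊗ Cat (n ∸ k))) d)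
U-origin n d = begin
    ⟦ U 0 (2 * n) ⟧ d
  ≡⟨ count-concat< (2 * n) _ d ⟩
    Σ< (2 * n) g
  ≡⟨ Σ<-pairs n g ⟩
    Σ< n (λ k → g (2 * k) + g (suc (2 * k)))
  ≡⟨ Σ<-cong n (λ k k<n → trans (cong₂ _+_ (even-tail k<n) (odd-tail k)) (+-identityʳ _)) ⟩
    Σ< n (λ k → (qpow (2 * k + 1) ⊗ (CatB k ⊗ Cat (n ∸ k))) d)
  ∎
  where
  g : ℕ → ℕ
  g s = ⟦ conv (Tail s) (A 1 0 (2 * n ∸ suc s)) ⟧ d
  -- an odd tail leaves an even number of steps to go from height 0 to height 1
  odd-tail : ∀ k → g (suc (2 * k)) ≡ 0
  odd-tail k = trans (cong (λ X → ⟦ conv (Tail (suc (2 * k))) X ⟧ d)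
      (A-odd (2 * n ∸ suc (suc (2 * k))) 1 0 (trans (cong (λ j → parity (suc j)) rest) (parity-odd (n ∸ suc k)))))
    (cong (λ X → ⟦ X ⟧ d) (conv-[]ʳ (Tail (suc (2 * k)))))
    where
    rest : 2 * n ∸ suc (suc (2 * k)) ≡ 2 * (n ∸ suc k)
    rest = sym (trans (*-distribˡ-∸ 2 n (suc k)) (cong (2 * n ∸_) (*-suc 2 k)))
  -- before an even tail lies a Dyck path of length 2 (n - k) minus its last step
  even-tail : ∀ {k} → k < n → g (2 * k) ≡ (qpow (2 * k + 1) ⊗ (CatB k ⊗ Cat (n ∸ k))) d
  even-tail {k} k<n = begin
      ⟦ conv (Tail (2 * k)) (A 1 0 (2 * n ∸ suc (2 * k))) ⟧ d
    ≡⟨ cong₂ (λ V X → ⟦ conv V X ⟧ d) (Tail-even k) prefix ⟩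
      ⟦ conv (map ((2 * k + 1) +_) (B 0 (2 * k))) (A 0 0 (2 * (n ∸ k))) ⟧ d
    ≡⟨ count-conv-shift (2 * k + 1) (B 0 (2 * k)) (A 0 0 (2 * (n ∸ k))) d ⟩
      (qpow (2 * k + 1) ⊗ (⟦ B 0 (2 * k) ⟧ ⊗ ⟦ A 0 0 (2 * (n ∸ k)) ⟧)) d
    ≡⟨ ⊗-congʳ (qpow (2 * k + 1)) (⊗-cong (≈P-sym (CatB-count k)) (≈P-sym (Cat-count (n ∸ k)))) d ⟩
      (qpow (2 * k + 1) ⊗ (CatB k ⊗ Cat (n ∸ k))) d
    ∎
    where
    prefix : A 1 0 (2 * n ∸ suc (2 * k)) ≡ A 0 0 (2 * (n ∸ k))
    prefix = trans (sym (A-last (2 * n ∸ suc (2 * k)) 0)) (cong (A 0 0)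
      (trans (sym (∸-pred (*-monoʳ-< 2 k<n))) (sym (*-distribˡ-∸ 2 n k))))

-- The identity holds for n = 0 as well.
theorem2 : (n : ℕ) → 1 ≤ n →
    CatB n ≈P (Cat n ⊕ ΣP< n (λ k → qpow (2 * k + 1) ⊗ (CatB k ⊗ Cat (n ∸ k))))
theorem2 n _ d = begin
    CatB n d
  ≡⟨ CatB-count n d ⟩
    ⟦ B 0 (2 * n) ⟧ d
  ≡⟨ B≋R (2 * n) 0 d ⟩
    ⟦ R 0 (2 * n) ⟧ d
  ≡⟨ count-++₄ (A 0 0 (2 * n)) (A 1 0 (2 * n)) (U 0 (2 * n)) [] d ⟩
    ⟦ A 0 0 (2 * n) ⟧ d + (⟦ A 1 0 (2 * n) ⟧ d + (⟦ U 0 (2 * n) ⟧ d + 0))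
  ≡⟨ cong₂ (λ X u → ⟦ A 0 0 (2 * n) ⟧ d + (⟦ X ⟧ d + (u + 0))) (A-odd (2 * n) 1 0 (parity-odd n)) (U-origin n d) ⟩
    ⟦ A 0 0 (2 * n) ⟧ d + (0 + (Σ< n (λ k → (qpow (2 * k + 1) ⊗ (CatB k ⊗ Cat (n ∸ k))) d) + 0))
  ≡⟨ cong₂ _+_ (sym (Cat-count n d)) (+-identityʳ _) ⟩
    (Cat n ⊕ ΣP< n (λ k → qpow (2 * k + 1) ⊗ (CatB k ⊗ Cat (n ∸ k)))) d
  ∎
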